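{- For all integers $n\ge 2$, \[ f(110,n)=\tfrac18(n^2-5n+8)2^n-\tfrac23 n^3+\tfrac72 n^2-\tfrac{35}{6}n+2. \]
   Context: For $\pi=\pi_1\cdots\pi_n\in S_n$, its index is the binary string $r^\pi=r_1\cdots r_{n-1}$ with $r_i=0$ if $\pi_i<\pi_{i+1}$ and $r_i=1$ if $\pi_i>\pi_{i+1}$. For a binary string $r$ ending in $0$, $f(r,n)$ is the number of $\pi\in S_n$ whose index is $rr'$ for some binary string $r'$ containing exactly one $1$. -}

module Defs where

open import Data.Bool using (Bool; true; false)
open import Data.Nat using (ℕ; zero; suc; _<ᵇ_)
open import Data.Fin using (Fin; toℕ)
open import Data.Fin.Properties as FinP using ()
open import Data.List using (List; []; _∷_; map; concatMap; filter; length; allFin; _++_)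
open import Data.List.Relation.Unary.Unique.Propositional using (Unique)
import Data.List.Relation.Unary.Unique.DecPropositional as UDP
open import Data.List.Relation.Unary.Any using (any?)
open import Data.Product using (∃; ∃-syntax; _×_; _,_)
open import Relation.Binary.PropositionalEquality using (_≡_; refl; cong)
import Data.Nat
open import Relation.Nullary using (Dec; yes; no)
import Data.List.Properties as ListP
import Data.Bool.Properties as BoolP

words : (n k : ℕ) → List (List (Fin n))
words n zero    = [] ∷ []
words n (suc k) = concatMap (λ i → map (i ∷_) (words n k)) (allFin n)

-- S_n: the permutations of {0,…,n-1} in one-line notation, i.e. the
-- duplicate-free words of length n over Fin n.
Sₙ : (n : ℕ) → List (List (Fin n))
Sₙ n = filter (UDP.unique? (FinP._≟_ {n})) (words n n)

-- The index (descent word) of a word: r_i = 1 (true) iff π_i > π_{i+1}.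
index : ∀ {n} → List (Fin n) → List Bool
index []           = []
index (x ∷ [])     = []
index (x ∷ y ∷ xs) = (toℕ y <ᵇ toℕ x) ∷ index (y ∷ xs)

ones : List Bool → ℕ
ones []          = 0
ones (true ∷ s)  = suc (ones s)
ones (false ∷ s) = ones s

HasForm : List Bool → List Bool → Set
HasForm r s = ∃[ r′ ] (s ≡ r ++ r′ × ones r′ ≡ 1)

hasForm? : (r s : List Bool) → Dec (HasForm r s)
hasForm? [] s with ones s Data.Nat.≟ 1
... | yes e = yes (s , refl , e)
... | no ¬e = no λ { (r′ , refl , e) → ¬e e }
hasForm? (b ∷ r) [] = no λ { (_ , () , _) }
hasForm? (b ∷ r) (c ∷ s) with c BoolP.≟ b | hasForm? r s
... | no c≢b | _ = no λ { (_ , refl , _) → c≢b refl }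
... | yes refl | yes (r′ , e , o) = yes (r′ , cong (c ∷_) e , o)
... | yes refl | no ¬h = no λ { (r′ , refl , o) → ¬h (r′ , refl , o) }

f : List Bool → ℕ → ℕ
f r n = length (filter (λ π → hasForm? r (index π)) (Sₙ n))

-- Inserting a new maximum into a permutation of [n] at each of its n + 1 positions produces every
-- permutation of [n + 1] exactly once.  On descent words, inserting it in front prepends a 1, and
-- inserting it right after the i-th entry replaces rᵢ by 01 (after the last entry: appends a 0).
-- Dually, the number G(w) of permutations with descent word w is the sum of G(v) over the words v
-- obtained from w by deleting the maximum.  For w = 1ᵖ0ʲ this is Pascal's rule, so G(1ᵖ0ʲ) is the
-- binomial coefficient C(p + j, p).  The permutations counted by f(110, n) are those with descent
-- word 1²0ᵃ⁺¹10ᵇ with a + b = n - 5; writing Tₚ(k) for the sum of G over the words 1ᵖ0ᵃ⁺¹10ᵇ with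
-- a + b = k, deleting the maximum gives
--   Tₚ(k + 1) = Tₚ₋₁(k + 1) + (k + 2) C(p + k + 2, p) + C(p + k + 2, p + 1) + 2 Tₚ(k),
-- which is solved in closed form for p = 0, 1, 2 in turn.
module Submission where

open import Defs
open import Data.Bool using (Bool; true; false; if_then_else_)
open import Data.Fin using (Fin; toℕ; fromℕ; inject₁)
import Data.Fin.Properties as Fin
open import Data.List using (List; []; _∷_; _++_; map; concatMap; filter; length; replicate)
open import Data.List.Membership.Propositional using (_∈_; _∉_)
open import Data.List.Relation.Binary.Permutation.Propositional using (_↭_)
open import Data.List.Relation.Unary.Any as Any using (here; there)
open import Data.Nat as ℕ using (ℕ; zero; suc; _≥_; s≤s)
open import Data.Nat.Combinatorics using (_C_; nC1≡n)
open import Data.Nat.Properties using (_≟_; suc-injective; +-identityʳ)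
open import Data.Product using (∃-syntax; _×_; _,_; proj₂)
open import Function using (_∘_; mk⇔)
open import Relation.Binary.Definitions using (DecidableEquality)
open import Relation.Binary.PropositionalEquality
  using (_≡_; _≢_; refl; sym; trans; cong; cong₂; subst; subst₂; module ≡-Reasoning)
open import Relation.Nullary using (¬_; Dec; does; yes; no; contradiction)

private variable
  A B : Set

module FiniteSums where

  import Algebra.Properties.CommutativeSemigroup as CommutativeSemigroupProperties
  open import Data.Bool.Properties using () renaming (_≟_ to _≟ᵇ_)
  open import Data.List.Properties using (≡-dec; map-++)
  import Data.List.Relation.Binary.Permutation.Propositional.Properties as ↭
  open import Data.Nat using (_+_; _*_)
  open import Data.Nat.ListAction using (sum)
  open import Data.Nat.ListAction.Properties using (sum-++; sum-↭)
  open import Data.Nat.Properties using (+-comm; +-commutativeSemigroup)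
  open import Relation.Nullary.Decidable using (does-⇔)
  open import Relation.Unary using (Decidable)
  open CommutativeSemigroupProperties +-commutativeSemigroup using ()
    renaming (interchange to +-interchange; x∙yz≈y∙xz to +-left-comm)

  ∑ : (A → ℕ) → List A → ℕ
  ∑ h = sum ∘ map h

  ∑-++ : ∀ (h : A → ℕ) xs ys → ∑ h (xs ++ ys) ≡ ∑ h xs + ∑ h ys
  ∑-++ h xs ys = trans (cong sum (map-++ h xs ys)) (sum-++ (map h xs) (map h ys))

  ∑-concatMap : ∀ (h : B → ℕ) (g : A → List B) xs → ∑ h (concatMap g xs) ≡ ∑ (∑ h ∘ g) xs
  ∑-concatMap h g []       = refl
  ∑-concatMap h g (x ∷ xs) = trans (∑-++ h (g x) _) (cong (∑ h (g x) +_) (∑-concatMap h g xs))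

  ∑-map : ∀ (h : B → ℕ) (g : A → B) xs → ∑ h (map g xs) ≡ ∑ (h ∘ g) xs
  ∑-map h g []       = refl
  ∑-map h g (x ∷ xs) = cong (h (g x) +_) (∑-map h g xs)

  ∑-cong : ∀ {g h : A → ℕ} xs → (∀ {x} → x ∈ xs → g x ≡ h x) → ∑ g xs ≡ ∑ h xs
  ∑-cong []       g≗h = refl
  ∑-cong (x ∷ xs) g≗h = cong₂ _+_ (g≗h (here refl)) (∑-cong xs (g≗h ∘ there))

  ∑-↭ : ∀ (h : A → ℕ) {xs ys} → xs ↭ ys → ∑ h xs ≡ ∑ h ys
  ∑-↭ h = sum-↭ ∘ ↭.map⁺ h

  ∑-zero : ∀ (xs : List A) → ∑ (λ _ → 0) xs ≡ 0
  ∑-zero []       = refl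
  ∑-zero (x ∷ xs) = ∑-zero xs

  ∑-+ : ∀ (g h : A → ℕ) xs → ∑ (λ x → g x + h x) xs ≡ ∑ g xs + ∑ h xs
  ∑-+ g h []       = refl
  ∑-+ g h (x ∷ xs) = begin
    g x + h x + ∑ (λ x → g x + h x) xs  ≡⟨ cong (g x + h x +_) (∑-+ g h xs) ⟩
    g x + h x + (∑ g xs + ∑ h xs)       ≡⟨ +-interchange (g x) (h x) _ _ ⟩
    g x + ∑ g xs + (h x + ∑ h xs)       ∎
    where open ≡-Reasoning

  ∑-comm : ∀ (h : A → B → ℕ) xs ys → ∑ (λ x → ∑ (h x) ys) xs ≡ ∑ (λ y → ∑ (λ x → h x y) xs) ys
  ∑-comm h []       ys = sym (∑-zero ys)
  ∑-comm h (x ∷ xs) ys = trans (cong (∑ (h x) ys +_) (∑-comm h xs ys)) (sym (∑-+ (h x) _ ys))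

  𝟙 : {P : Set} → Dec P → ℕ
  𝟙 P? = if does P? then 1 else 0

  length-filter≡∑𝟙 : ∀ {P : A → Set} (P? : Decidable P) xs → length (filter P? xs) ≡ ∑ (𝟙 ∘ P?) xs
  length-filter≡∑𝟙 P? []       = refl
  length-filter≡∑𝟙 P? (x ∷ xs) with does (P? x)
  ... | true  = cong suc (length-filter≡∑𝟙 P? xs)
  ... | false = length-filter≡∑𝟙 P? xs

  _≟ᴸ_ : DecidableEquality (List Bool)
  _≟ᴸ_ = ≡-dec _≟ᵇ_

  δ : List Bool → List Bool → ℕ
  δ w u = 𝟙 (w ≟ᴸ u)

  δ-sym : ∀ w u → δ w u ≡ δ u w
  δ-sym w u = cong (λ b → if b then 1 else 0) (does-⇔ (mk⇔ sym sym) (w ≟ᴸ u) (u ≟ᴸ w))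

  antidiagonalSum : ℕ → (ℕ → ℕ → ℕ) → ℕ
  antidiagonalSum zero    h = h 0 0
  antidiagonalSum (suc k) h = h 0 (suc k) + antidiagonalSum k (λ a b → h (suc a) b)

  antidiagonalSum-cong : ∀ k {g h : ℕ → ℕ → ℕ} → (∀ a b → a + b ≡ k → g a b ≡ h a b) →
                         antidiagonalSum k g ≡ antidiagonalSum k h
  antidiagonalSum-cong zero    g≗h = g≗h 0 0 refl
  antidiagonalSum-cong (suc k) g≗h =
    cong₂ _+_ (g≗h 0 (suc k) refl) (antidiagonalSum-cong k (λ a b → g≗h (suc a) b ∘ cong suc))

  antidiagonalSum-zero : ∀ k → antidiagonalSum k (λ _ _ → 0) ≡ 0
  antidiagonalSum-zero zero    = refl
  antidiagonalSum-zero (suc k) = antidiagonalSum-zero k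

  antidiagonalSum-const : ∀ k c → antidiagonalSum k (λ _ _ → c) ≡ suc k * c
  antidiagonalSum-const zero    c = sym (+-identityʳ c)
  antidiagonalSum-const (suc k) c = cong (c +_) (antidiagonalSum-const k c)

  antidiagonalSum-+ : ∀ k (g h : ℕ → ℕ → ℕ) →
                      antidiagonalSum k (λ a b → g a b + h a b) ≡ antidiagonalSum k g + antidiagonalSum k h
  antidiagonalSum-+ zero    g h = refl
  antidiagonalSum-+ (suc k) g h =
    trans (cong (g 0 (suc k) + h 0 (suc k) +_) (antidiagonalSum-+ k (λ a → g (suc a)) (λ a → h (suc a))))
          (+-interchange (g 0 (suc k)) (h 0 (suc k)) _ _)

  antidiagonalSum-last : ∀ k h →
                         antidiagonalSum (suc k) h ≡ h (suc k) 0 + antidiagonalSum k (λ a b → h a (suc b))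
  antidiagonalSum-last zero    h = +-comm (h 0 1) (h 1 0)
  antidiagonalSum-last (suc k) h =
    trans (cong (h 0 (suc (suc k)) +_) (antidiagonalSum-last k (λ a → h (suc a))))
          (+-left-comm (h 0 (suc (suc k))) (h (suc (suc k)) 0) _)

  ∑-antidiagonalSum : ∀ k (h : A → ℕ → ℕ → ℕ) xs →
                      ∑ (λ x → antidiagonalSum k (h x)) xs ≡ antidiagonalSum k (λ a b → ∑ (λ x → h x a b) xs)
  ∑-antidiagonalSum k h []       = sym (antidiagonalSum-zero k)
  ∑-antidiagonalSum k h (x ∷ xs) =
    trans (cong (antidiagonalSum k (h x) +_) (∑-antidiagonalSum k h xs)) (sym (antidiagonalSum-+ k (h x) _))

open FiniteSums

module Extensions where

  open import Data.Empty using (⊥-elim)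
  open import Data.Fin.Relation.Unary.Top using (view; ‵fromℕ; ‵inject₁)
  open import Data.List using (allFin; lookup)
  open import Data.List.Properties using (length-map; map-injective; ∷-injectiveˡ; ∷-injectiveʳ)
  open import Data.List.Membership.Propositional.Properties
    using (∈-map⁺; ∈-map⁻; ∈-concatMap⁺; ∈-concatMap⁻; ∈-concat⁺′; ∈-concat⁻′;
           ∈-filter⁺; ∈-filter⁻; ∈-allFin; ∈-lookup)
  open import Data.List.Membership.Propositional.Properties.WithK using (unique∧set⇒bag)
  open import Data.List.Relation.Binary.BagAndSetEquality using (∼bag⇒↭)
  open import Data.List.Relation.Binary.Disjoint.Propositional using (Disjoint)
  open import Data.List.Relation.Unary.All as All using ([]; _∷_)
  import Data.List.Relation.Unary.All.Properties as All
  open import Data.List.Relation.Unary.AllPairs as AllPairs using ([]; _∷_)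
  import Data.List.Relation.Unary.AllPairs.Properties as AllPairs
  open import Data.List.Relation.Unary.Unique.Propositional using (Unique)
  import Data.List.Relation.Unary.Unique.Propositional.Properties as Unique
  import Data.List.Relation.Unary.Unique.DecPropositional as UniqueDec
  open import Data.Nat using (_≤_; _≤?_)
  open import Data.Nat.Properties using (≰⇒>; <⇒≢; n≮n)
  open import Data.Sum using (_⊎_; inj₁; inj₂)

  lookup-injective : ∀ (xs : List A) → Unique xs → ∀ i j → lookup xs i ≡ lookup xs j → i ≡ j
  lookup-injective (x ∷ xs) (x∉ ∷ xs!) Fin.zero    Fin.zero    eq = refl
  lookup-injective (x ∷ xs) (x∉ ∷ xs!) Fin.zero    (Fin.suc j) eq = contradiction eq (All.lookup x∉ (∈-lookup j))
  lookup-injective (x ∷ xs) (x∉ ∷ xs!) (Fin.suc i) Fin.zero    eq =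
    contradiction (sym eq) (All.lookup x∉ (∈-lookup i))
  lookup-injective (x ∷ xs) (x∉ ∷ xs!) (Fin.suc i) (Fin.suc j) eq = cong Fin.suc (lookup-injective xs xs! i j eq)

  length-unique≤ : ∀ {n} (xs : List (Fin n)) → Unique xs → length xs ≤ n
  length-unique≤ {n} xs xs! with length xs ≤? n
  ... | yes ≤n = ≤n
  ... | no  ≰n with Fin.pigeonhole (≰⇒> ≰n) (lookup xs)
  ...   | i , j , i<j , eq = contradiction (cong toℕ (lookup-injective xs xs! i j eq)) (<⇒≢ i<j)

  fromℕ∉⇒map-inject₁ : ∀ {n} (xs : List (Fin (suc n))) → fromℕ n ∉ xs → ∃[ ys ] map inject₁ ys ≡ xs
  fromℕ∉⇒map-inject₁ []       _ = [] , refl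
  fromℕ∉⇒map-inject₁ (x ∷ xs) n∉ with view x | fromℕ∉⇒map-inject₁ xs (n∉ ∘ there)
  ... | ‵fromℕ     | _         = ⊥-elim (n∉ (here refl))
  ... | ‵inject₁ i | ys , refl = i ∷ ys , refl

  fromℕ∉map-inject₁ : ∀ {n} (xs : List (Fin n)) → fromℕ n ∉ map inject₁ xs
  fromℕ∉map-inject₁ xs n∈ with ∈-map⁻ inject₁ n∈
  ... | _ , _ , eq = Fin.fromℕ≢inject₁ eq

  insertions : A → List A → List (List A)
  insertions x []       = (x ∷ []) ∷ []
  insertions x (y ∷ ys) = (x ∷ y ∷ ys) ∷ map (y ∷_) (insertions x ys)

  length-∈-insertions : ∀ {x : A} ys {z} → z ∈ insertions x ys → length z ≡ suc (length ys)
  length-∈-insertions []       (here refl) = refl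
  length-∈-insertions (y ∷ ys) (here refl) = refl
  length-∈-insertions (y ∷ ys) (there z∈) with ∈-map⁻ (y ∷_) z∈
  ... | z′ , z′∈ , refl = cong suc (length-∈-insertions ys z′∈)

  ∈-∈-insertions : ∀ {x : A} ys {z e} → z ∈ insertions x ys → e ∈ z → e ≡ x ⊎ e ∈ ys
  ∈-∈-insertions []       (here refl) (here e≡x) = inj₁ e≡x
  ∈-∈-insertions (y ∷ ys) (here refl) (here e≡x) = inj₁ e≡x
  ∈-∈-insertions (y ∷ ys) (here refl) (there e∈) = inj₂ e∈
  ∈-∈-insertions (y ∷ ys) (there z∈) e∈ with ∈-map⁻ (y ∷_) z∈
  ∈-∈-insertions (y ∷ ys) (there z∈) (here e≡y) | _ , _ , refl = inj₂ (here e≡y)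
  ∈-∈-insertions (y ∷ ys) (there z∈) (there e∈) | _ , z′∈ , refl with ∈-∈-insertions ys z′∈ e∈
  ... | inj₁ e≡x  = inj₁ e≡x
  ... | inj₂ e∈ys = inj₂ (there e∈ys)

  unique-∈-insertions : ∀ {x : A} ys {z} → x ∉ ys → Unique ys → z ∈ insertions x ys → Unique z
  unique-∈-insertions []       _  _           (here refl) = [] ∷ []
  unique-∈-insertions (y ∷ ys) x∉ ys!         (here refl) = All.¬Any⇒All¬ _ x∉ ∷ ys!
  unique-∈-insertions (y ∷ ys) x∉ (y∉ ∷ ys!) (there z∈) with ∈-map⁻ (y ∷_) z∈
  ... | z′ , z′∈ , refl = All.tabulate y≢ ∷ unique-∈-insertions ys (x∉ ∘ there) ys! z′∈
    where
    y≢ : ∀ {e} → e ∈ z′ → y ≢ e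
    y≢ e∈ with ∈-∈-insertions ys z′∈ e∈
    ... | inj₁ refl = x∉ ∘ here ∘ sym
    ... | inj₂ e∈ys = All.lookup y∉ e∈ys

  insertions-unique : ∀ {x : A} ys → x ∉ ys → Unique (insertions x ys)
  insertions-unique []       _  = [] ∷ []
  insertions-unique (y ∷ ys) x∉ =
    All.tabulate first≢ ∷ Unique.map⁺ ∷-injectiveʳ (insertions-unique ys (x∉ ∘ there))
    where
    first≢ : ∀ {z} → z ∈ map (y ∷_) (insertions _ ys) → _ ≢ z
    first≢ z∈ eq with ∈-map⁻ (y ∷_) z∈
    ... | _ , _ , refl = x∉ (here (∷-injectiveˡ eq))

  module _ (_≟_ : DecidableEquality A) where

    deleteFirst : A → List A → List A
    deleteFirst x []       = []
    deleteFirst x (y ∷ ys) with x ≟ y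
    ... | yes _ = ys
    ... | no  _ = y ∷ deleteFirst x ys

    deleteFirst-∈-insertions : ∀ {x} ys {z} → x ∉ ys → z ∈ insertions x ys → deleteFirst x z ≡ ys
    deleteFirst-∈-insertions {x} []       _  (here refl) with x ≟ x
    ... | yes _   = refl
    ... | no  x≢x = contradiction refl x≢x
    deleteFirst-∈-insertions {x} (y ∷ ys) _  (here refl) with x ≟ x
    ... | yes _   = refl
    ... | no  x≢x = contradiction refl x≢x
    deleteFirst-∈-insertions {x} (y ∷ ys) x∉ (there z∈) with ∈-map⁻ (y ∷_) z∈
    ... | z′ , z′∈ , refl with x ≟ y
    ...   | yes x≡y = contradiction (here x≡y) x∉
    ...   | no  _   = cong (y ∷_) (deleteFirst-∈-insertions ys (x∉ ∘ there) z′∈)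

    ∈-insertions-deleteFirst : ∀ {x} z → x ∈ z → z ∈ insertions x (deleteFirst x z)
    ∈-insertions-deleteFirst {x} (y ∷ ys) x∈ with x ≟ y
    ∈-insertions-deleteFirst (y ∷ [])    _          | yes refl = here refl
    ∈-insertions-deleteFirst (y ∷ _ ∷ _) _          | yes refl = here refl
    ∈-insertions-deleteFirst (y ∷ ys)    (here x≡y) | no  x≢y  = contradiction x≡y x≢y
    ∈-insertions-deleteFirst (y ∷ ys)    (there x∈) | no  _    =
      there (∈-map⁺ (y ∷_) (∈-insertions-deleteFirst ys x∈))

    length-deleteFirst : ∀ {x} z → x ∈ z → suc (length (deleteFirst x z)) ≡ length z
    length-deleteFirst {x} (y ∷ ys) x∈ with x ≟ y
    length-deleteFirst (y ∷ ys) _          | yes _   = refl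
    length-deleteFirst (y ∷ ys) (here x≡y) | no  x≢y = contradiction x≡y x≢y
    length-deleteFirst (y ∷ ys) (there x∈) | no  _   = cong suc (length-deleteFirst ys x∈)

    deleteFirst-⊆ : ∀ {x} z {e} → e ∈ deleteFirst x z → e ∈ z
    deleteFirst-⊆ {x} (y ∷ ys) e∈ with x ≟ y
    deleteFirst-⊆ (y ∷ ys) e∈         | yes _ = there e∈
    deleteFirst-⊆ (y ∷ ys) (here e≡y) | no  _ = here e≡y
    deleteFirst-⊆ (y ∷ ys) (there e∈) | no  _ = there (deleteFirst-⊆ ys e∈)

    deleteFirst-unique : ∀ {x} z → Unique z → Unique (deleteFirst x z)
    deleteFirst-unique     []       z!         = z!
    deleteFirst-unique {x} (y ∷ ys) (y∉ ∷ ys!) with x ≟ y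
    ... | yes _ = ys!
    ... | no  _ = All.tabulate (All.lookup y∉ ∘ deleteFirst-⊆ ys) ∷ deleteFirst-unique ys ys!

    ∉-deleteFirst : ∀ {x} z → Unique z → x ∉ deleteFirst x z
    ∉-deleteFirst {x} (y ∷ ys) (y∉ ∷ ys!) x∈ with x ≟ y
    ∉-deleteFirst (y ∷ ys) (y∉ ∷ ys!) x∈         | yes refl = All.lookup y∉ x∈ refl
    ∉-deleteFirst (y ∷ ys) (y∉ ∷ ys!) (here x≡y) | no  x≢y  = x≢y x≡y
    ∉-deleteFirst (y ∷ ys) (y∉ ∷ ys!) (there x∈) | no  _    = ∉-deleteFirst ys ys! x∈

  ∈-words⁻ : ∀ {n} k {z} → z ∈ words n k → length z ≡ k
  ∈-words⁻ zero    (here refl) = refl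
  ∈-words⁻ {n} (suc k) z∈
    with Any.satisfied (∈-concatMap⁻ (λ i → map (i ∷_) (words n k)) {xs = allFin n} z∈)
  ... | i , z∈ᵢ with ∈-map⁻ (i ∷_) z∈ᵢ
  ... | z′ , z′∈ , refl = cong suc (∈-words⁻ k z′∈)

  ∈-words⁺ : ∀ {n} (z : List (Fin n)) → z ∈ words n (length z)
  ∈-words⁺ []          = here refl
  ∈-words⁺ {n} (i ∷ z) = ∈-concatMap⁺ (λ j → map (j ∷_) (words n (length z)))
                                       (Any.map (λ { refl → ∈-map⁺ (i ∷_) (∈-words⁺ z) }) (∈-allFin i))

  words-unique : ∀ n k → Unique (words n k)
  words-unique n zero    = [] ∷ []
  words-unique n (suc k) =
    Unique.concat⁺ (All.map⁺ (All.tabulate⁺ λ i → Unique.map⁺ ∷-injectiveʳ (words-unique n k)))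
                   (AllPairs.map⁺ (AllPairs.map disjoint (Unique.allFin⁺ n)))
    where
    disjoint : ∀ {i j} → i ≢ j → Disjoint (map (i ∷_) (words n k)) (map (j ∷_) (words n k))
    disjoint i≢j (p , q) with ∈-map⁻ _ p | ∈-map⁻ _ q
    ... | _ , _ , refl | _ , _ , eq = i≢j (∷-injectiveˡ eq)

  ∈-Sₙ⁻ : ∀ {n z} → z ∈ Sₙ n → Unique z × length z ≡ n
  ∈-Sₙ⁻ {n} z∈ with ∈-filter⁻ (UniqueDec.unique? Fin._≟_) {xs = words n n} z∈
  ... | z∈words , z! = z! , ∈-words⁻ n z∈words

  ∈-Sₙ⁺ : ∀ {n z} → Unique z → length z ≡ n → z ∈ Sₙ n
  ∈-Sₙ⁺ {z = z} z! |z| =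
    ∈-filter⁺ (UniqueDec.unique? Fin._≟_) (subst (λ k → z ∈ words _ k) |z| (∈-words⁺ z)) z!

  Sₙ-unique : ∀ n → Unique (Sₙ n)
  Sₙ-unique n = Unique.filter⁺ (UniqueDec.unique? Fin._≟_) (words-unique n n)

  fromℕ∈Sₙ : ∀ {n z} → z ∈ Sₙ (suc n) → fromℕ n ∈ z
  fromℕ∈Sₙ {n} {z} z∈ with ∈-Sₙ⁻ z∈ | fromℕ n ∈? z
    where open import Data.List.Membership.DecPropositional (Fin._≟_ {suc n}) using (_∈?_)
  ... | _        | yes n∈ = n∈
  ... | z! , |z| | no  n∉ with fromℕ∉⇒map-inject₁ z n∉
  ...   | ys , refl = contradiction (length-unique≤ ys (Unique.map⁻ z!))
                                    (subst (λ m → ¬ m ≤ n) (trans (sym |z|) (length-map inject₁ ys)) (n≮n n))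

  extensions : ∀ {n} → List (Fin n) → List (List (Fin (suc n)))
  extensions {n} σ = insertions (fromℕ n) (map inject₁ σ)

  ∈-Sₙ-suc⇒∈-extensions : ∀ {n z} → z ∈ Sₙ (suc n) → z ∈ concatMap extensions (Sₙ n)
  ∈-Sₙ-suc⇒∈-extensions {n} {z} z∈ with ∈-Sₙ⁻ z∈
  ... | z! , |z| with fromℕ∉⇒map-inject₁ (deleteFirst Fin._≟_ (fromℕ n) z) (∉-deleteFirst Fin._≟_ z z!)
  ... | σ , σ↑ = ∈-concat⁺′ z∈extσ (∈-map⁺ extensions σ∈)
    where
    open ≡-Reasoning
    n∈ = fromℕ∈Sₙ z∈
    z∈extσ : z ∈ extensions σ
    z∈extσ = subst (λ l → z ∈ insertions (fromℕ n) l) (sym σ↑) (∈-insertions-deleteFirst Fin._≟_ z n∈)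
    σ∈ : σ ∈ Sₙ n
    σ∈ = ∈-Sₙ⁺ (Unique.map⁻ (subst Unique (sym σ↑) (deleteFirst-unique Fin._≟_ z z!))) (suc-injective (begin
      suc (length σ)                                        ≡⟨ cong suc (length-map inject₁ σ) ⟨
      suc (length (map inject₁ σ))                          ≡⟨ cong (suc ∘ length) σ↑ ⟩
      suc (length (deleteFirst Fin._≟_ (fromℕ n) z))       ≡⟨ length-deleteFirst Fin._≟_ z n∈ ⟩
      length z                                              ≡⟨ |z| ⟩
      suc n                                                 ∎))

  ∈-extensions⇒∈-Sₙ-suc : ∀ {n z} → z ∈ concatMap extensions (Sₙ n) → z ∈ Sₙ (suc n)
  ∈-extensions⇒∈-Sₙ-suc {n} z∈ with ∈-concat⁻′ (map extensions (Sₙ n)) z∈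
  ... | zs , z∈zs , zs∈ with ∈-map⁻ extensions zs∈
  ... | σ , σ∈ , refl with ∈-Sₙ⁻ σ∈
  ... | σ! , |σ| =
    ∈-Sₙ⁺ (unique-∈-insertions _ (fromℕ∉map-inject₁ σ) (Unique.map⁺ Fin.inject₁-injective σ!) z∈zs)
          (trans (length-∈-insertions _ z∈zs) (cong suc (trans (length-map inject₁ σ) |σ|)))

  extensions-disjoint : ∀ {n} {σ σ′ : List (Fin n)} → σ ≢ σ′ → Disjoint (extensions σ) (extensions σ′)
  extensions-disjoint {σ = σ} {σ′} σ≢σ′ (z∈ , z∈′) =
    σ≢σ′ (map-injective Fin.inject₁-injective
           (trans (sym (deleteFirst-∈-insertions Fin._≟_ _ (fromℕ∉map-inject₁ σ) z∈))
                  (deleteFirst-∈-insertions Fin._≟_ _ (fromℕ∉map-inject₁ σ′) z∈′)))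

  concatMap-extensions-unique : ∀ n → Unique (concatMap extensions (Sₙ n))
  concatMap-extensions-unique n =
    Unique.concat⁺ (All.map⁺ (All.tabulate λ {σ} _ → insertions-unique _ (fromℕ∉map-inject₁ σ)))
                   (AllPairs.map⁺ (AllPairs.map extensions-disjoint (Sₙ-unique n)))

  Sₙ-suc↭extensions : ∀ n → Sₙ (suc n) ↭ concatMap extensions (Sₙ n)
  Sₙ-suc↭extensions n = ∼bag⇒↭ (unique∧set⇒bag (Sₙ-unique (suc n)) (concatMap-extensions-unique n)
                                               (mk⇔ ∈-Sₙ-suc⇒∈-extensions ∈-extensions⇒∈-Sₙ-suc))

open Extensions

module DescentWords where

  open import Data.List.Properties using (map-∘)
  open import Data.List.Relation.Unary.All as All using (All; []; _∷_)
  import Data.List.Relation.Unary.All.Properties as All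
  open import Data.Nat using (_+_; _<_; _<ᵇ_)

  insertMaxAfter : List Bool → List (List Bool)
  insertMaxAfter []      = (false ∷ []) ∷ []
  insertMaxAfter (b ∷ u) = (false ∷ true ∷ u) ∷ map (b ∷_) (insertMaxAfter u)

  -- Only meaningful for the descent word u of a nonempty permutation: the empty permutation has a
  -- single extension.
  insertMax : List Bool → List (List Bool)
  insertMax u = (true ∷ u) ∷ insertMaxAfter u

  deleteMaxFront : List Bool → List (List Bool)
  deleteMaxFront (true ∷ w) = w ∷ []
  deleteMaxFront _          = []

  deleteMaxAfter : List Bool → List (List Bool)
  deleteMaxAfter []                  = []
  deleteMaxAfter (false ∷ [])        = [] ∷ []
  deleteMaxAfter (false ∷ true ∷ w)  = (false ∷ w) ∷ (true ∷ w) ∷ map (false ∷_) (deleteMaxAfter (true ∷ w))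
  deleteMaxAfter (false ∷ false ∷ w) = map (false ∷_) (deleteMaxAfter (false ∷ w))
  deleteMaxAfter (true ∷ w)          = map (true ∷_) (deleteMaxAfter w)

  deleteMax : List Bool → List (List Bool)
  deleteMax w = deleteMaxFront w ++ deleteMaxAfter w

  ∑δ-map-∷ : ∀ b w L → ∑ (δ (b ∷ w)) (map (b ∷_) L) ≡ ∑ (δ w) L
  ∑δ-map-∷ true  w L = ∑-map (δ (true ∷ w)) (true ∷_) L
  ∑δ-map-∷ false w L = ∑-map (δ (false ∷ w)) (false ∷_) L

  ∑δ-true-map-false : ∀ w L → ∑ (δ (true ∷ w)) (map (false ∷_) L) ≡ 0
  ∑δ-true-map-false w L = trans (∑-map (δ (true ∷ w)) (false ∷_) L) (∑-zero L)

  ∑δ-false-map-true : ∀ w L → ∑ (δ (false ∷ w)) (map (true ∷_) L) ≡ 0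
  ∑δ-false-map-true w L = trans (∑-map (δ (false ∷ w)) (true ∷_) L) (∑-zero L)

  ∑δ-[]-map : ∀ b L → ∑ (δ []) (map (b ∷_) L) ≡ 0
  ∑δ-[]-map b L = trans (∑-map (δ []) (b ∷_) L) (∑-zero L)

  ∑δ-insertMaxAfter : ∀ u w → ∑ (δ w) (insertMaxAfter u) ≡ ∑ (δ u) (deleteMaxAfter w)
  ∑δ-insertMaxAfter []          []                  = refl
  ∑δ-insertMaxAfter []          (false ∷ [])        = refl
  ∑δ-insertMaxAfter []          (false ∷ true ∷ w)  = sym (∑δ-[]-map false (deleteMaxAfter (true ∷ w)))
  ∑δ-insertMaxAfter []          (false ∷ false ∷ w) = sym (∑δ-[]-map false (deleteMaxAfter (false ∷ w)))
  ∑δ-insertMaxAfter []          (true ∷ w)          = sym (∑δ-[]-map true (deleteMaxAfter w))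
  ∑δ-insertMaxAfter (b ∷ u)     []                  = ∑δ-[]-map b (insertMaxAfter u)
  ∑δ-insertMaxAfter (true ∷ u)  (false ∷ [])        = ∑δ-false-map-true [] (insertMaxAfter u)
  ∑δ-insertMaxAfter (false ∷ u) (false ∷ [])        =
    trans (∑δ-map-∷ false [] (insertMaxAfter u)) (∑δ-insertMaxAfter u [])
  ∑δ-insertMaxAfter (true ∷ u)  (false ∷ true ∷ w)  = cong₂ _+_ (δ-sym w u) (trans
    (∑δ-false-map-true (true ∷ w) (insertMaxAfter u))
    (sym (∑δ-true-map-false u (deleteMaxAfter (true ∷ w)))))
  ∑δ-insertMaxAfter (false ∷ u) (false ∷ true ∷ w)  = cong₂ _+_ (δ-sym w u) (begin
    ∑ (δ (false ∷ true ∷ w)) (map (false ∷_) (insertMaxAfter u))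
      ≡⟨ ∑δ-map-∷ false (true ∷ w) (insertMaxAfter u) ⟩
    ∑ (δ (true ∷ w)) (insertMaxAfter u)
      ≡⟨ ∑δ-insertMaxAfter u (true ∷ w) ⟩
    ∑ (δ u) (deleteMaxAfter (true ∷ w))
      ≡⟨ ∑δ-map-∷ false u (deleteMaxAfter (true ∷ w)) ⟨
    ∑ (δ (false ∷ u)) (map (false ∷_) (deleteMaxAfter (true ∷ w))) ∎)
    where open ≡-Reasoning
  ∑δ-insertMaxAfter (true ∷ u)  (false ∷ false ∷ w) = trans
    (∑δ-false-map-true (false ∷ w) (insertMaxAfter u))
    (sym (∑δ-true-map-false u (deleteMaxAfter (false ∷ w))))
  ∑δ-insertMaxAfter (false ∷ u) (false ∷ false ∷ w) = trans
    (∑δ-map-∷ false (false ∷ w) (insertMaxAfter u))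
    (trans (∑δ-insertMaxAfter u (false ∷ w)) (sym (∑δ-map-∷ false u (deleteMaxAfter (false ∷ w)))))
  ∑δ-insertMaxAfter (true ∷ u)  (true ∷ w)          = trans
    (∑δ-map-∷ true w (insertMaxAfter u))
    (trans (∑δ-insertMaxAfter u w) (sym (∑δ-map-∷ true u (deleteMaxAfter w))))
  ∑δ-insertMaxAfter (false ∷ u) (true ∷ w)          =
    trans (∑δ-true-map-false w (insertMaxAfter u)) (sym (∑δ-false-map-true u (deleteMaxAfter w)))

  ∑δ-insertMax : ∀ u w → ∑ (δ w) (insertMax u) ≡ ∑ (δ u) (deleteMax w)
  ∑δ-insertMax u w =
    trans (cong₂ _+_ (front w) (∑δ-insertMaxAfter u w)) (sym (∑-++ (δ u) (deleteMaxFront w) _))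
    where
    front : ∀ w → δ w (true ∷ u) ≡ ∑ (δ u) (deleteMaxFront w)
    front []          = refl
    front (true ∷ w)  = trans (δ-sym w u) (sym (+-identityʳ (δ u w)))
    front (false ∷ w) = refl

  <⇒<ᵇ≡true : ∀ {m n} → m < n → (m <ᵇ n) ≡ true
  <⇒<ᵇ≡true {zero}  {suc n} _         = refl
  <⇒<ᵇ≡true {suc m} {suc n} (s≤s m<n) = <⇒<ᵇ≡true m<n

  <⇒>ᵇ≡false : ∀ {m n} → m < n → (n <ᵇ m) ≡ false
  <⇒>ᵇ≡false {zero}  {suc n} _         = refl
  <⇒>ᵇ≡false {suc m} {suc n} (s≤s m<n) = <⇒>ᵇ≡false m<n

  index-map-inject₁ : ∀ {n} (σ : List (Fin n)) → index (map inject₁ σ) ≡ index σ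
  index-map-inject₁ []           = refl
  index-map-inject₁ (y ∷ [])     = refl
  index-map-inject₁ (y ∷ z ∷ zs) =
    cong₂ _∷_ (cong₂ _<ᵇ_ (Fin.toℕ-inject₁ z) (Fin.toℕ-inject₁ y)) (index-map-inject₁ (z ∷ zs))

  module _ {n} {x : Fin n} where

    index-insertions-after : ∀ y ys → All (λ e → toℕ e < toℕ x) (y ∷ ys) →
                             map (λ t → index (y ∷ t)) (insertions x ys) ≡ insertMaxAfter (index (y ∷ ys))
    index-insertions-after y []       (y<x ∷ [])         = cong (λ b → (b ∷ []) ∷ []) (<⇒>ᵇ≡false y<x)
    index-insertions-after y (z ∷ zs) (y<x ∷ z<x ∷ zs<x) =
      cong₂ _∷_ (cong₂ (λ b c → b ∷ c ∷ index (z ∷ zs)) (<⇒>ᵇ≡false y<x) (<⇒<ᵇ≡true z<x)) (begin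
        map (λ t → index (y ∷ t)) (map (z ∷_) (insertions x zs))
          ≡⟨ map-∘ (insertions x zs) ⟨
        map (λ t → (toℕ z <ᵇ toℕ y) ∷ index (z ∷ t)) (insertions x zs)
          ≡⟨ map-∘ (insertions x zs) ⟩
        map ((toℕ z <ᵇ toℕ y) ∷_) (map (λ t → index (z ∷ t)) (insertions x zs))
          ≡⟨ cong (map _) (index-insertions-after z zs (z<x ∷ zs<x)) ⟩
        map ((toℕ z <ᵇ toℕ y) ∷_) (insertMaxAfter (index (z ∷ zs))) ∎)
      where open ≡-Reasoning

    index-insertions : ∀ y ys → All (λ e → toℕ e < toℕ x) (y ∷ ys) →
                       map index (insertions x (y ∷ ys)) ≡ insertMax (index (y ∷ ys))
    index-insertions y ys ys<x@(y<x ∷ _) =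
      cong₂ _∷_ (cong (_∷ index (y ∷ ys)) (<⇒<ᵇ≡true y<x))
                (trans (sym (map-∘ (insertions x ys))) (index-insertions-after y ys ys<x))

  index-extensions : ∀ {n} y (ys : List (Fin n)) → map index (extensions (y ∷ ys)) ≡ insertMax (index (y ∷ ys))
  index-extensions {n} y ys =
    trans (index-insertions (inject₁ y) (map inject₁ ys) (All.map⁺ (All.universal inject₁<fromℕ (y ∷ ys))))
          (cong insertMax (index-map-inject₁ (y ∷ ys)))
    where
    inject₁<fromℕ : ∀ (e : Fin n) → toℕ (inject₁ e) < toℕ (fromℕ n)
    inject₁<fromℕ e = subst₂ _<_ (sym (Fin.toℕ-inject₁ e)) (sym (Fin.toℕ-fromℕ n)) (Fin.toℕ<n e)

  descentCount : ℕ → List Bool → ℕ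
  descentCount n w = ∑ (δ w ∘ index) (Sₙ n)

  descentCount-suc : ∀ n w → descentCount (suc (suc n)) w ≡ ∑ (descentCount (suc n)) (deleteMax w)
  descentCount-suc n w = begin
    ∑ (δ w ∘ index) (Sₙ (suc (suc n)))
      ≡⟨ ∑-↭ (δ w ∘ index) (Sₙ-suc↭extensions (suc n)) ⟩
    ∑ (δ w ∘ index) (concatMap extensions S)
      ≡⟨ ∑-concatMap (δ w ∘ index) extensions S ⟩
    ∑ (λ σ → ∑ (δ w ∘ index) (extensions σ)) S
      ≡⟨ ∑-cong S extension-step ⟩
    ∑ (λ σ → ∑ (δ (index σ)) (deleteMax w)) S
      ≡⟨ ∑-comm (λ σ → δ (index σ)) S (deleteMax w) ⟩
    ∑ (λ v → ∑ (λ σ → δ (index σ) v) S) (deleteMax w)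
      ≡⟨ ∑-cong (deleteMax w) (λ {v} _ → ∑-cong S λ {σ} _ → δ-sym (index σ) v) ⟩
    ∑ (descentCount (suc n)) (deleteMax w) ∎
    where
    open ≡-Reasoning
    S = Sₙ (suc n)
    extension-step : ∀ {σ} → σ ∈ S → ∑ (δ w ∘ index) (extensions σ) ≡ ∑ (δ (index σ)) (deleteMax w)
    extension-step {[]}     σ∈ with () ← proj₂ (∈-Sₙ⁻ σ∈)
    extension-step {y ∷ ys} _  = begin
      ∑ (δ w ∘ index) (extensions (y ∷ ys))      ≡⟨ ∑-map (δ w) index (extensions (y ∷ ys)) ⟨
      ∑ (δ w) (map index (extensions (y ∷ ys)))  ≡⟨ cong (∑ (δ w)) (index-extensions y ys) ⟩
      ∑ (δ w) (insertMax (index (y ∷ ys)))       ≡⟨ ∑δ-insertMax (index (y ∷ ys)) w ⟩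
      ∑ (δ (index (y ∷ ys))) (deleteMax w)       ∎

open DescentWords

module ValleyCounts where

  open import Data.List.Properties using (map-id; map-∘)
  open import Data.Nat using (_+_; _*_; z≤n)
  open import Data.Nat.Combinatorics using (nCn≡1; nCk≡nC[n∸k]; nCk+nC[k+1]≡[n+1]C[k+1])
  open import Data.Nat.Properties using (+-suc; *-assoc; *-distribˡ-+)
  open import Data.Nat.Tactic.RingSolver using (solve-∀; solve)
  open import Relation.Nullary.Decidable using (does-⇔)

  nC0≡1 : ∀ n → n C 0 ≡ 1
  nC0≡1 n = trans (nCk≡nC[n∸k] {n = n} z≤n) (nCn≡1 n)

  2*[1+n]C2 : ∀ n → 2 * (suc n C 2) ≡ suc n * n
  2*[1+n]C2 zero    = refl
  2*[1+n]C2 (suc n) = begin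
    2 * (suc (suc n) C 2)              ≡⟨ cong (2 *_) (nCk+nC[k+1]≡[n+1]C[k+1] (suc n) 1) ⟨
    2 * (suc n C 1 + suc n C 2)        ≡⟨ *-distribˡ-+ 2 (suc n C 1) (suc n C 2) ⟩
    2 * (suc n C 1) + 2 * (suc n C 2)  ≡⟨ cong₂ (λ c d → 2 * c + d) (nC1≡n (suc n)) (2*[1+n]C2 n) ⟩
    2 * suc n + suc n * n              ≡⟨ solve (n ∷ []) ⟩
    suc (suc n) * suc n                ∎
    where open ≡-Reasoning

  6*[2+n]C3 : ∀ n → 6 * (suc (suc n) C 3) ≡ suc (suc n) * suc n * n
  6*[2+n]C3 zero    = refl
  6*[2+n]C3 (suc n) = begin
    6 * (suc (suc (suc n)) C 3)
      ≡⟨ cong (6 *_) (nCk+nC[k+1]≡[n+1]C[k+1] (suc (suc n)) 2) ⟨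
    6 * (suc (suc n) C 2 + suc (suc n) C 3)
      ≡⟨ *-distribˡ-+ 6 (suc (suc n) C 2) (suc (suc n) C 3) ⟩
    6 * (suc (suc n) C 2) + 6 * (suc (suc n) C 3)
      ≡⟨ cong (_+ 6 * (suc (suc n) C 3)) (*-assoc 3 2 (suc (suc n) C 2)) ⟩
    3 * (2 * (suc (suc n) C 2)) + 6 * (suc (suc n) C 3)
      ≡⟨ cong₂ (λ c d → 3 * c + d) (2*[1+n]C2 (suc n)) (6*[2+n]C3 n) ⟩
    3 * (suc (suc n) * suc n) + suc (suc n) * suc n * n
      ≡⟨ solve (n ∷ []) ⟩
    suc (suc (suc n)) * suc (suc n) * suc n ∎
    where open ≡-Reasoning

  replicate-++-∷ : ∀ n (x : A) xs → replicate n x ++ x ∷ xs ≡ x ∷ replicate n x ++ xs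
  replicate-++-∷ zero    x xs = refl
  replicate-++-∷ (suc n) x xs = cong (x ∷_) (replicate-++-∷ n x xs)

  replicate-++-replicate : ∀ m n (x : A) → replicate m x ++ replicate n x ≡ replicate (m + n) x
  replicate-++-replicate zero    n x = refl
  replicate-++-replicate (suc m) n x = cong (x ∷_) (replicate-++-replicate m n x)

  oneValley : ℕ → ℕ → List Bool
  oneValley p j = replicate p true ++ replicate j false

  oneValley⁺ : ℕ → ℕ → ℕ → List Bool
  oneValley⁺ p a b = replicate p true ++ replicate a false ++ true ∷ replicate b false

  twoValleys : ℕ → ℕ → ℕ → List Bool
  twoValleys p a = oneValley⁺ p (suc a)

  oneValley⁺-zero : ∀ p b → oneValley⁺ p 0 b ≡ oneValley (suc p) b
  oneValley⁺-zero p b = replicate-++-∷ p true (replicate b false)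

  deleteMaxAfter-descents : ∀ p w →
                            deleteMaxAfter (replicate p true ++ w) ≡ map (replicate p true ++_) (deleteMaxAfter w)
  deleteMaxAfter-descents zero    w = sym (map-id (deleteMaxAfter w))
  deleteMaxAfter-descents (suc p) w =
    trans (cong (map (true ∷_)) (deleteMaxAfter-descents p w)) (sym (map-∘ (deleteMaxAfter w)))

  deleteMaxAfter-ascents : ∀ j → deleteMaxAfter (replicate (suc j) false) ≡ replicate j false ∷ []
  deleteMaxAfter-ascents zero    = refl
  deleteMaxAfter-ascents (suc j) = cong (map (false ∷_)) (deleteMaxAfter-ascents j)

  deleteMaxAfter-ascents-descent : ∀ a w → deleteMaxAfter (replicate (suc a) false ++ true ∷ w) ≡
                                           map (replicate a false ++_) (deleteMaxAfter (false ∷ true ∷ w))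
  deleteMaxAfter-ascents-descent zero    w = sym (map-id _)
  deleteMaxAfter-ascents-descent (suc a) w =
    trans (cong (map (false ∷_)) (deleteMaxAfter-ascents-descent a w))
          (sym (map-∘ (deleteMaxAfter (false ∷ true ∷ w))))

  deleteMaxAfter-oneValley : ∀ p j → deleteMaxAfter (oneValley p (suc j)) ≡ oneValley p j ∷ []
  deleteMaxAfter-oneValley p j = trans (deleteMaxAfter-descents p (replicate (suc j) false))
                                       (cong (map (replicate p true ++_)) (deleteMaxAfter-ascents j))

  descentCount-oneValley : ∀ p j → descentCount (suc (p + j)) (oneValley p j) ≡ (p + j) C p
  descentCount-oneValley zero    zero    = refl
  descentCount-oneValley zero    (suc j) = begin
    descentCount (suc (suc j)) (oneValley 0 (suc j))
      ≡⟨ descentCount-suc j (oneValley 0 (suc j)) ⟩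
    ∑ (descentCount (suc j)) (deleteMaxAfter (oneValley 0 (suc j)))
      ≡⟨ cong (∑ (descentCount (suc j))) (deleteMaxAfter-oneValley 0 j) ⟩
    descentCount (suc j) (oneValley 0 j) + 0
      ≡⟨ trans (+-identityʳ _) (descentCount-oneValley 0 j) ⟩
    j C 0
      ≡⟨ trans (nC0≡1 j) (sym (nC0≡1 (suc j))) ⟩
    suc j C 0 ∎
    where open ≡-Reasoning
  descentCount-oneValley (suc p) zero    = begin
    descentCount (suc (suc (p + 0))) (oneValley (suc p) 0)
      ≡⟨ descentCount-suc (p + 0) (oneValley (suc p) 0) ⟩
    g (oneValley p 0) + ∑ g (deleteMaxAfter (oneValley (suc p) 0))
      ≡⟨ cong (λ vs → g (oneValley p 0) + ∑ g vs) (deleteMaxAfter-descents (suc p) []) ⟩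
    g (oneValley p 0) + 0
      ≡⟨ trans (+-identityʳ _) (descentCount-oneValley p 0) ⟩
    (p + 0) C p
      ≡⟨ trans (n+0Cn≡1 p) (sym (n+0Cn≡1 (suc p))) ⟩
    (suc p + 0) C suc p ∎
    where
    open ≡-Reasoning
    g = descentCount (suc (p + 0))
    n+0Cn≡1 : ∀ n → (n + 0) C n ≡ 1
    n+0Cn≡1 n = trans (cong (_C n) (+-identityʳ n)) (nCn≡1 n)
  descentCount-oneValley (suc p) (suc j) = begin
    descentCount (suc (suc (p + suc j))) (oneValley (suc p) (suc j))
      ≡⟨ descentCount-suc (p + suc j) (oneValley (suc p) (suc j)) ⟩
    g (oneValley p (suc j)) + ∑ g (deleteMaxAfter (oneValley (suc p) (suc j)))
      ≡⟨ cong (λ vs → g (oneValley p (suc j)) + ∑ g vs) (deleteMaxAfter-oneValley (suc p) j) ⟩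
    g (oneValley p (suc j)) + (g (oneValley (suc p) j) + 0)
      ≡⟨ cong₂ _+_ (descentCount-oneValley p (suc j)) (trans (+-identityʳ _) shorter) ⟩
    (p + suc j) C p + (p + suc j) C suc p
      ≡⟨ nCk+nC[k+1]≡[n+1]C[k+1] (p + suc j) p ⟩
    (suc p + suc j) C suc p ∎
    where
    open ≡-Reasoning
    g = descentCount (suc (p + suc j))
    shorter : g (oneValley (suc p) j) ≡ (p + suc j) C suc p
    shorter = begin
      g (oneValley (suc p) j)
        ≡⟨ cong (λ m → descentCount (suc m) (oneValley (suc p) j)) (+-suc p j) ⟩
      descentCount (suc (suc p + j)) (oneValley (suc p) j)
        ≡⟨ descentCount-oneValley (suc p) j ⟩
      (suc p + j) C suc p
        ≡⟨ cong (_C suc p) (+-suc p j) ⟨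
      (p + suc j) C suc p ∎

  onPred : (ℕ → ℕ) → ℕ → ℕ
  onPred g zero    = 0
  onPred g (suc n) = g n

  ∑-deleteMaxAfter-twoValleys : ∀ (h : List Bool → ℕ) p a b →
    ∑ h (deleteMaxAfter (twoValleys p a b)) ≡
    h (oneValley p (suc (a + b))) + (h (oneValley⁺ p a b) + onPred (h ∘ twoValleys p a) b)
  ∑-deleteMaxAfter-twoValleys h p a b = begin
    ∑ h (deleteMaxAfter (Pₚ ++ replicate (suc a) false ++ true ∷ Rᵦ))
      ≡⟨ cong (∑ h) (deleteMaxAfter-descents p (replicate (suc a) false ++ true ∷ Rᵦ)) ⟩
    ∑ h (map (Pₚ ++_) (deleteMaxAfter (replicate (suc a) false ++ true ∷ Rᵦ)))
      ≡⟨ cong (∑ h ∘ map (Pₚ ++_)) (deleteMaxAfter-ascents-descent a Rᵦ) ⟩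
    ∑ h (map (Pₚ ++_) (map (Aₐ ++_) (deleteMaxAfter (false ∷ true ∷ Rᵦ))))
      ≡⟨ trans (∑-map h (Pₚ ++_) (map (Aₐ ++_) (deleteMaxAfter (false ∷ true ∷ Rᵦ))))
               (∑-map (h ∘ (Pₚ ++_)) (Aₐ ++_) (deleteMaxAfter (false ∷ true ∷ Rᵦ))) ⟩
    h′ (false ∷ Rᵦ) + (h′ (true ∷ Rᵦ) + ∑ h′ (map (false ∷_) (map (true ∷_) (deleteMaxAfter Rᵦ))))
      ≡⟨ cong₂ (λ m t → m + (h (oneValley⁺ p a b) + t)) merged (trailing b) ⟩
    h (oneValley p (suc (a + b))) + (h (oneValley⁺ p a b) + onPred (h ∘ twoValleys p a) b) ∎
    where
    open ≡-Reasoning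
    Pₚ = replicate p true
    Aₐ = replicate a false
    Rᵦ = replicate b false
    h′ : List Bool → ℕ
    h′ w = h (Pₚ ++ Aₐ ++ w)

    merged : h′ (false ∷ Rᵦ) ≡ h (oneValley p (suc (a + b)))
    merged = cong (λ w → h (Pₚ ++ w))
                  (trans (replicate-++-∷ a false Rᵦ) (cong (false ∷_) (replicate-++-replicate a b false)))

    trailing : ∀ b → ∑ h′ (map (false ∷_) (map (true ∷_) (deleteMaxAfter (replicate b false))))
                     ≡ onPred (h ∘ twoValleys p a) b
    trailing zero    = refl
    trailing (suc b) = begin
      ∑ h′ (map (false ∷_) (map (true ∷_) (deleteMaxAfter (replicate (suc b) false))))
        ≡⟨ cong (λ vs → ∑ h′ (map (false ∷_) (map (true ∷_) vs))) (deleteMaxAfter-ascents b) ⟩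
      h′ (false ∷ true ∷ replicate b false) + 0
        ≡⟨ +-identityʳ _ ⟩
      h (Pₚ ++ Aₐ ++ false ∷ true ∷ replicate b false)
        ≡⟨ cong (λ w → h (Pₚ ++ w)) (replicate-++-∷ a false (true ∷ replicate b false)) ⟩
      h (twoValleys p a b) ∎

  -- Deleting the maximum from 1ᵖ0ᵃ⁺¹10ᵇ: in front (if p > 0), at the peak, turning its 01 into 0 or
  -- into 1, or at the end (if b > 0).
  ∑-deleteMax-twoValleys : ∀ (h : List Bool → ℕ) p a b →
    ∑ h (deleteMax (twoValleys p a b)) ≡
    onPred (λ p′ → h (twoValleys p′ a b)) p
      + (h (oneValley p (suc (a + b))) + (h (oneValley⁺ p a b) + onPred (h ∘ twoValleys p a) b))
  ∑-deleteMax-twoValleys h zero    a b = ∑-deleteMaxAfter-twoValleys h zero a b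
  ∑-deleteMax-twoValleys h (suc p) a b =
    cong (h (twoValleys p a b) +_) (∑-deleteMaxAfter-twoValleys h (suc p) a b)

  antidiagonalSum-deleteMax-twoValleys : ∀ (h : List Bool → ℕ) p k →
    antidiagonalSum (suc k) (λ a b → ∑ h (deleteMax (twoValleys p a b))) ≡
    onPred (λ p′ → antidiagonalSum (suc k) (λ a b → h (twoValleys p′ a b))) p + (2 + k) * h (oneValley p (2 + k))
      + h (oneValley (suc p) (suc k)) + 2 * antidiagonalSum k (λ a b → h (twoValleys p a b))
  antidiagonalSum-deleteMax-twoValleys h p k = begin
    antidiagonalSum (suc k) (λ a b → ∑ h (deleteMax (twoValleys p a b)))
      ≡⟨ antidiagonalSum-cong (suc k) (λ a b _ → ∑-deleteMax-twoValleys h p a b) ⟩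
    antidiagonalSum (suc k) (λ a b → front a b + (middle a b + (hook a b + trailing a b)))
      ≡⟨ antidiagonalSum-+ (suc k) front (λ a b → middle a b + (hook a b + trailing a b)) ⟩
    Σ front + antidiagonalSum (suc k) (λ a b → middle a b + (hook a b + trailing a b))
      ≡⟨ cong (Σ front +_) (antidiagonalSum-+ (suc k) middle (λ a b → hook a b + trailing a b)) ⟩
    Σ front + (Σ middle + antidiagonalSum (suc k) (λ a b → hook a b + trailing a b))
      ≡⟨ cong (λ s → Σ front + (Σ middle + s)) (antidiagonalSum-+ (suc k) hook trailing) ⟩
    Σ front + (Σ middle + (Σ hook + Σ trailing))
      ≡⟨ cong₂ _+_ (leading p) (cong₂ _+_ Σmiddle≡ (cong₂ _+_ Σhook≡ (antidiagonalSum-last k trailing))) ⟩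
    F + ((2 + k) * M + ((H + T) + (0 + T)))
      ≡⟨ regroup F ((2 + k) * M) H T ⟩
    F + (2 + k) * M + H + 2 * T ∎
    where
    open ≡-Reasoning
    front middle hook trailing : ℕ → ℕ → ℕ
    front    a b = onPred (λ p′ → h (twoValleys p′ a b)) p
    middle   a b = h (oneValley p (suc (a + b)))
    hook     a b = h (oneValley⁺ p a b)
    trailing a b = onPred (h ∘ twoValleys p a) b
    Σ : (ℕ → ℕ → ℕ) → ℕ
    Σ = antidiagonalSum (suc k)
    F M H T : ℕ
    F = onPred (λ p′ → Σ (λ a b → h (twoValleys p′ a b))) p
    M = h (oneValley p (2 + k))
    H = h (oneValley (suc p) (suc k))
    T = antidiagonalSum k (λ a b → h (twoValleys p a b))

    leading : ∀ q → Σ (λ a b → onPred (λ q′ → h (twoValleys q′ a b)) q)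
                    ≡ onPred (λ q′ → Σ (λ a b → h (twoValleys q′ a b))) q
    leading zero    = antidiagonalSum-zero (suc k)
    leading (suc q) = refl

    Σmiddle≡ : Σ middle ≡ (2 + k) * M
    Σmiddle≡ = trans (antidiagonalSum-cong (suc k) (λ a b a+b≡ → cong (λ m → h (oneValley p (suc m))) a+b≡))
                     (antidiagonalSum-const (suc k) M)

    Σhook≡ : Σ hook ≡ H + T
    Σhook≡ = cong (λ w → h w + T) (oneValley⁺-zero p (suc k))

    regroup : ∀ f m c t → f + (m + ((c + t) + (0 + t))) ≡ f + m + c + 2 * t
    regroup = solve-∀

  twoValleyCount : ℕ → ℕ → ℕ
  twoValleyCount p k = antidiagonalSum k λ a b → descentCount (3 + (p + k)) (twoValleys p a b)

  twoValleyCount-suc : ∀ p k → twoValleyCount p (suc k) ≡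
    onPred (λ p′ → twoValleyCount p′ (suc k)) p + (2 + k) * ((p + (2 + k)) C p) + (suc p + suc k) C suc p
      + 2 * twoValleyCount p k
  twoValleyCount-suc p k = begin
    twoValleyCount p (suc k)
      ≡⟨ antidiagonalSum-cong (suc k) (λ a b _ → descentCount-suc (suc (p + suc k)) (twoValleys p a b)) ⟩
    antidiagonalSum (suc k) (λ a b → ∑ g (deleteMax (twoValleys p a b)))
      ≡⟨ antidiagonalSum-deleteMax-twoValleys g p k ⟩
    onPred (λ p′ → antidiagonalSum (suc k) (λ a b → g (twoValleys p′ a b))) p + (2 + k) * g (oneValley p (2 + k))
      + g (oneValley (suc p) (suc k)) + 2 * antidiagonalSum k (λ a b → g (twoValleys p a b))
      ≡⟨ cong₂ _+_ (cong₂ _+_ (cong₂ _+_ (leading p) (cong ((2 + k) *_) g-oneValley))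
                              (descentCount-oneValley (suc p) (suc k)))
                   (cong (2 *_) shifted) ⟩
    onPred (λ p′ → twoValleyCount p′ (suc k)) p + (2 + k) * ((p + (2 + k)) C p) + (suc p + suc k) C suc p
      + 2 * twoValleyCount p k ∎
    where
    open ≡-Reasoning
    g = descentCount (suc (suc (p + suc k)))

    leading : ∀ q → onPred (λ q′ → antidiagonalSum (suc k) λ a b →
                                     descentCount (suc (suc (q + suc k))) (twoValleys q′ a b)) q
                    ≡ onPred (λ q′ → twoValleyCount q′ (suc k)) q
    leading zero    = refl
    leading (suc q) = refl

    g-oneValley : g (oneValley p (2 + k)) ≡ (p + (2 + k)) C p
    g-oneValley = trans (cong (λ m → descentCount (suc m) (oneValley p (2 + k))) (sym (+-suc p (suc k))))
                        (descentCount-oneValley p (2 + k))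

    shifted : antidiagonalSum k (λ a b → g (twoValleys p a b)) ≡ twoValleyCount p k
    shifted = cong (λ m → antidiagonalSum k λ a b → descentCount (suc (suc m)) (twoValleys p a b)) (+-suc p k)

  𝟙[ones≡0] : ∀ k r → length r ≡ k → 𝟙 (ones r ≟ 0) ≡ δ (replicate k false) r
  𝟙[ones≡0] zero    []          _ = refl
  𝟙[ones≡0] (suc k) (true ∷ r)  _ = refl
  𝟙[ones≡0] (suc k) (false ∷ r) e = 𝟙[ones≡0] k r (suc-injective e)

  𝟙[ones≡1] : ∀ k r → length r ≡ suc k →
              𝟙 (ones r ≟ 1) ≡ antidiagonalSum k λ a b → δ (replicate a false ++ true ∷ replicate b false) r
  𝟙[ones≡1] zero    (true ∷ r)     e = 𝟙[ones≡0] 0 r (suc-injective e)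
  𝟙[ones≡1] zero    (false ∷ [])   _ = refl
  𝟙[ones≡1] (suc k) (true ∷ r)     e =
    trans (𝟙[ones≡0] (suc k) r (suc-injective e))
          (sym (trans (cong (δ (replicate (suc k) false) r +_) (antidiagonalSum-zero k)) (+-identityʳ _)))
  𝟙[ones≡1] (suc k) (false ∷ r)    e = 𝟙[ones≡1] k r (suc-injective e)

  𝟙-hasForm-110 : ∀ k u → length u ≡ 4 + k →
                  𝟙 (hasForm? (true ∷ true ∷ false ∷ []) u) ≡ antidiagonalSum k λ a b → δ (twoValleys 2 a b) u
  𝟙-hasForm-110 k (true ∷ true ∷ false ∷ r) e =
    trans (cong (λ b → if b then 1 else 0)
                (does-⇔ (mk⇔ (λ { (_ , refl , o) → o }) (λ o → r , refl , o))
                        (hasForm? (true ∷ true ∷ false ∷ []) (true ∷ true ∷ false ∷ r)) (ones r ≟ 1)))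
          (𝟙[ones≡1] k r (suc-injective (suc-injective (suc-injective e))))
  𝟙-hasForm-110 k (true ∷ true ∷ true ∷ r)  _ = sym (antidiagonalSum-zero k)
  𝟙-hasForm-110 k (true ∷ false ∷ _ ∷ r)    _ = sym (antidiagonalSum-zero k)
  𝟙-hasForm-110 k (false ∷ _ ∷ _ ∷ r)       _ = sym (antidiagonalSum-zero k)

  length-index : ∀ {n} x (xs : List (Fin n)) → length (index (x ∷ xs)) ≡ length xs
  length-index x []       = refl
  length-index x (y ∷ xs) = cong suc (length-index y xs)

  𝟙-hasForm-110-index : ∀ {n k} (π : List (Fin n)) → length π ≡ 5 + k →
    𝟙 (hasForm? (true ∷ true ∷ false ∷ []) (index π))
      ≡ antidiagonalSum k λ a b → δ (twoValleys 2 a b) (index π)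
  𝟙-hasForm-110-index {k = k} (x ∷ xs) |π| =
    𝟙-hasForm-110 k (index (x ∷ xs)) (trans (length-index x xs) (suc-injective |π|))

  f-110≡twoValleyCount : ∀ k → f (true ∷ true ∷ false ∷ []) (5 + k) ≡ twoValleyCount 2 k
  f-110≡twoValleyCount k = begin
    length (filter (λ π → hasForm? r110 (index π)) S)
      ≡⟨ length-filter≡∑𝟙 (λ π → hasForm? r110 (index π)) S ⟩
    ∑ (λ π → 𝟙 (hasForm? r110 (index π))) S
      ≡⟨ ∑-cong S (λ {π} π∈ → 𝟙-hasForm-110-index π (proj₂ (∈-Sₙ⁻ π∈))) ⟩
    ∑ (λ π → antidiagonalSum k λ a b → δ (twoValleys 2 a b) (index π)) S
      ≡⟨ ∑-antidiagonalSum k (λ π a b → δ (twoValleys 2 a b) (index π)) S ⟩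
    twoValleyCount 2 k ∎
    where
    open ≡-Reasoning
    r110 = true ∷ true ∷ false ∷ []
    S = Sₙ (5 + k)

open ValleyCounts

open import Data.Integer using (ℤ; +_; _+_; _-_; _*_; _^_)
open import Data.Integer.Properties using (pos-*)
open import Data.Integer.Tactic.RingSolver using (solve-∀; solve)

-- The ring solver does not unfold Data.Integer._^_, so squares and cubes are written as products.
closedForm₀ closedForm₁ closedForm₂ : ℕ → ℤ
closedForm₀ n = (+ 2) ^ n - + 2 * + n
closedForm₁ n = (+ n - + 2) * (+ 2) ^ n - + 3 * (+ n * + n) + + 7 * + n - + 2
closedForm₂ n = + 3 * (+ n * + n - + 5 * + n + + 8) * (+ 2) ^ n
              - + 16 * (+ n * + n * + n) + + 84 * (+ n * + n) - + 140 * + n + + 48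

closedForm₂-powers : ∀ n → closedForm₂ n ≡
  + 3 * ((+ n) ^ 2 - + 5 * + n + + 8) * (+ 2) ^ n - + 16 * (+ n) ^ 3 + + 84 * (+ n) ^ 2 - + 140 * + n + + 48
closedForm₂-powers n =
  cong₂ (λ s c → + 3 * (s - + 5 * + n + + 8) * (+ 2) ^ n - + 16 * c + + 84 * s - + 140 * + n + + 48)
        (square (+ n)) (cube (+ n))
  where
  square : ∀ ν → ν * ν ≡ ν * (ν * + 1)
  square = solve-∀
  cube : ∀ ν → ν * ν * ν ≡ ν * (ν * (ν * + 1))
  cube = solve-∀

pos-2*[1+n]C2 : ∀ n → + 2 * + (suc n C 2) ≡ + suc n * + n
pos-2*[1+n]C2 n = trans (sym (pos-* 2 (suc n C 2))) (trans (cong +_ (2*[1+n]C2 n)) (pos-* (suc n) n))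

pos-6*[2+n]C3 : ∀ n → + 6 * + (suc (suc n) C 3) ≡ + suc (suc n) * + suc n * + n
pos-6*[2+n]C3 n = trans (sym (pos-* 6 (suc (suc n) C 3))) (trans (cong +_ (6*[2+n]C3 n))
  (trans (pos-* (suc (suc n) ℕ.* suc n) n) (cong (_* + n) (pos-* (suc (suc n)) (suc n)))))

pos-recurrence : ∀ a m c d t → + (a ℕ.+ m ℕ.* c ℕ.+ d ℕ.+ 2 ℕ.* t) ≡ + a + + m * + c + + d + + 2 * + t
pos-recurrence a m c d t = cong₂ (λ u v → + a + u + + d + v) (pos-* m c) (pos-* 2 t)

-- In the step lemmas κ stands for k and x for 2ⁿ, where n is the size of the permutations counted
-- by the last hypothesis.
closedForm₀-step : ∀ κ x {c₀ c₁ t} → c₀ ≡ + 1 → c₁ ≡ + 2 + κ → t ≡ x - + 2 * (+ 3 + κ) →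
  + 0 + (+ 2 + κ) * c₀ + c₁ + + 2 * t ≡ + 2 * x - + 2 * (+ 4 + κ)
closedForm₀-step κ x refl refl refl = solve (κ ∷ x ∷ [])

closedForm₁-step : ∀ κ x {t₀ c₁ 2c₂ 2t₁} → let ν = + 4 + κ in
  t₀ ≡ x - + 2 * ν → c₁ ≡ + 3 + κ → 2c₂ ≡ (+ 3 + κ) * (+ 2 + κ) →
  2t₁ ≡ (ν - + 2) * x - + 3 * (ν * ν) + + 7 * ν - + 2 →
  + 2 * t₀ + + 2 * (+ 2 + κ) * c₁ + 2c₂ + + 2 * 2t₁
    ≡ (+ 1 + ν - + 2) * (+ 2 * x) - + 3 * ((+ 1 + ν) * (+ 1 + ν)) + + 7 * (+ 1 + ν) - + 2
closedForm₁-step κ x refl refl refl refl = solve (κ ∷ x ∷ [])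

closedForm₂-step : ∀ κ x {2t₁ 2c₂ 6c₃ 24t₂} → let ν = + 5 + κ in
  2t₁ ≡ (ν - + 2) * x - + 3 * (ν * ν) + + 7 * ν - + 2 →
  2c₂ ≡ (+ 4 + κ) * (+ 3 + κ) → 6c₃ ≡ (+ 4 + κ) * (+ 3 + κ) * (+ 2 + κ) →
  24t₂ ≡ + 3 * (ν * ν - + 5 * ν + + 8) * x - + 16 * (ν * ν * ν) + + 84 * (ν * ν) - + 140 * ν + + 48 →
  + 12 * 2t₁ + + 12 * (+ 2 + κ) * 2c₂ + + 4 * 6c₃ + + 2 * 24t₂
    ≡ + 3 * ((+ 1 + ν) * (+ 1 + ν) - + 5 * (+ 1 + ν) + + 8) * (+ 2 * x)
      - + 16 * ((+ 1 + ν) * (+ 1 + ν) * (+ 1 + ν)) + + 84 * ((+ 1 + ν) * (+ 1 + ν)) - + 140 * (+ 1 + ν) + + 48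
closedForm₂-step κ x refl refl refl refl = solve (κ ∷ x ∷ [])

twoValleyCount₀ : ∀ k → + twoValleyCount 0 k ≡ closedForm₀ (3 ℕ.+ k)
twoValleyCount₀ zero    = refl
twoValleyCount₀ (suc k) = begin
  + twoValleyCount 0 (suc k)
    ≡⟨ trans (cong +_ (twoValleyCount-suc 0 k)) (pos-recurrence 0 (2 ℕ.+ k) c₀ c₁ t₀) ⟩
  + 0 + + (2 ℕ.+ k) * + c₀ + + c₁ + + 2 * + t₀
    ≡⟨ closedForm₀-step (+ k) ((+ 2) ^ (3 ℕ.+ k))
         (cong +_ (nC0≡1 (2 ℕ.+ k))) (cong +_ (nC1≡n (2 ℕ.+ k))) (twoValleyCount₀ k) ⟩
  closedForm₀ (4 ℕ.+ k) ∎
  where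
  open ≡-Reasoning
  c₀ = (2 ℕ.+ k) C 0
  c₁ = (2 ℕ.+ k) C 1
  t₀ = twoValleyCount 0 k

twoValleyCount₁ : ∀ k → + 2 * + twoValleyCount 1 k ≡ closedForm₁ (4 ℕ.+ k)
twoValleyCount₁ zero    = refl
twoValleyCount₁ (suc k) = begin
  + 2 * + twoValleyCount 1 (suc k)
    ≡⟨ cong (+ 2 *_) (trans (cong +_ (twoValleyCount-suc 1 k)) (pos-recurrence t₀ (2 ℕ.+ k) c₁ c₂ t₁)) ⟩
  + 2 * (+ t₀ + + (2 ℕ.+ k) * + c₁ + + c₂ + + 2 * + t₁)
    ≡⟨ regroup (+ t₀) (+ (2 ℕ.+ k)) (+ c₁) (+ c₂) (+ t₁) ⟩
  + 2 * + t₀ + + 2 * + (2 ℕ.+ k) * + c₁ + + 2 * + c₂ + + 2 * (+ 2 * + t₁)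
    ≡⟨ closedForm₁-step (+ k) ((+ 2) ^ (4 ℕ.+ k))
         (twoValleyCount₀ (suc k)) (cong +_ (nC1≡n (3 ℕ.+ k))) (pos-2*[1+n]C2 (2 ℕ.+ k)) (twoValleyCount₁ k) ⟩
  closedForm₁ (5 ℕ.+ k) ∎
  where
  open ≡-Reasoning
  t₀ = twoValleyCount 0 (suc k)
  c₁ = (3 ℕ.+ k) C 1
  c₂ = (3 ℕ.+ k) C 2
  t₁ = twoValleyCount 1 k
  regroup : ∀ t₀ m c₁ c₂ t₁ →
            + 2 * (t₀ + m * c₁ + c₂ + + 2 * t₁) ≡ + 2 * t₀ + + 2 * m * c₁ + + 2 * c₂ + + 2 * (+ 2 * t₁)
  regroup = solve-∀

twoValleyCount₂ : ∀ k → + 24 * + twoValleyCount 2 k ≡ closedForm₂ (5 ℕ.+ k)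
twoValleyCount₂ zero    = refl
twoValleyCount₂ (suc k) = begin
  + 24 * + twoValleyCount 2 (suc k)
    ≡⟨ cong (+ 24 *_) (trans (cong +_ (twoValleyCount-suc 2 k)) (pos-recurrence t₁ (2 ℕ.+ k) c₂ c₃ t₂)) ⟩
  + 24 * (+ t₁ + + (2 ℕ.+ k) * + c₂ + + c₃ + + 2 * + t₂)
    ≡⟨ regroup (+ t₁) (+ (2 ℕ.+ k)) (+ c₂) (+ c₃) (+ t₂) ⟩
  + 12 * (+ 2 * + t₁) + + 12 * + (2 ℕ.+ k) * (+ 2 * + c₂) + + 4 * (+ 6 * + c₃) + + 2 * (+ 24 * + t₂)
    ≡⟨ closedForm₂-step (+ k) ((+ 2) ^ (5 ℕ.+ k))
         (twoValleyCount₁ (suc k)) (pos-2*[1+n]C2 (3 ℕ.+ k)) (pos-6*[2+n]C3 (2 ℕ.+ k)) (twoValleyCount₂ k) ⟩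
  closedForm₂ (6 ℕ.+ k) ∎
  where
  open ≡-Reasoning
  t₁ = twoValleyCount 1 (suc k)
  c₂ = (4 ℕ.+ k) C 2
  c₃ = (4 ℕ.+ k) C 3
  t₂ = twoValleyCount 2 k
  regroup : ∀ t₁ m c₂ c₃ t₂ → + 24 * (t₁ + m * c₂ + c₃ + + 2 * t₂)
                              ≡ + 12 * (+ 2 * t₁) + + 12 * m * (+ 2 * c₂) + + 4 * (+ 6 * c₃) + + 2 * (+ 24 * t₂)
  regroup = solve-∀

lemma4p4 : (n : ℕ) → n ≥ 2 →
    + 24 * + f (true ∷ true ∷ false ∷ []) n
      ≡ + 3 * ((+ n) ^ 2 - + 5 * + n + + 8) * (+ 2) ^ n
        - + 16 * (+ n) ^ 3 + + 84 * (+ n) ^ 2 - + 140 * + n + + 48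
lemma4p4 0 ()
lemma4p4 1 (s≤s ())
lemma4p4 2 _ = refl
lemma4p4 3 _ = refl
lemma4p4 4 _ = refl
lemma4p4 (suc (suc (suc (suc (suc k))))) _ = begin
  + 24 * + f (true ∷ true ∷ false ∷ []) (5 ℕ.+ k)  ≡⟨ cong (λ m → + 24 * + m) (f-110≡twoValleyCount k) ⟩
  + 24 * + twoValleyCount 2 k                     ≡⟨ twoValleyCount₂ k ⟩
  closedForm₂ (5 ℕ.+ k)                           ≡⟨ closedForm₂-powers (5 ℕ.+ k) ⟩
  _                                               ∎
  where open ≡-Reasoning
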